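{- Fix integers $q\ge 2$ and $t\ge 2$. Let $\mathcal F$ be a random $k\times n$ array whose entries are chosen independently and uniformly from $\{0,1,\ldots,q-1\}$. Let $\Gamma$ and $\Delta$ be distinct, non-disjoint sets of $t$ columns, and let $r=|\Gamma\cap\Delta|$ (so $1\le r\le t-1$). For a set $\Lambda$ of $t$ columns let $I_\Lambda$ be the indicator that at least one of the $q^t$ words of length $t$ over $\{0,\ldots,q-1\}$ does not appear in any row of $\mathcal F$ restricted to the columns of $\Lambda$. Then \[\mathbb P(I_\Gamma I_\Delta=1)\le q^{2t-r}\left(\frac{q^t+q^{r-t}-2}{q^t}\right)^k\{1+o(1)\}\qquad (k\to\infty).\] -}

module Defs where

open import Data.Nat as ℕ using (ℕ; zero; suc; _^_; _*_; _∸_; NonZero)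
open import Data.Nat.Properties using (m^n≢0)
open import Data.Integer using (+_)
open import Data.Rational as ℚ using (ℚ; 0ℚ; 1ℚ; _/_)
open import Data.Fin using (Fin)
open import Data.Fin.Subset using (Subset; _∈_)
open import Data.Fin.Subset.Properties using (_∈?_)
open import Data.Fin.Properties using (any?; all?)
open import Data.Vec using (Vec; []; _∷_; lookup)
open import Data.List as List using (List; length; filter; allFin; concatMap)
open import Data.Product using (∃; _×_; _,_)
open import Relation.Nullary using (Dec; ¬_; _→-dec_; ¬?; _×-dec_)
open import Relation.Nullary.Decidable using (map′)
open import Relation.Binary.PropositionalEquality using (_≡_)
open import Data.Fin.Properties using (_≟_)

Array : ℕ → ℕ → ℕ → Set
Array q k n = Vec (Vec (Fin q) n) k

-- The row `row`, restricted to the columns of Λ, equals the word w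
-- (a word on the columns of Λ is given by its values on Λ; values of w
-- outside Λ are irrelevant).
Covers : ∀ {q n} → Subset n → Vec (Fin q) n → Vec (Fin q) n → Set
Covers Λ row w = ∀ j → j ∈ Λ → lookup row j ≡ lookup w j

IndicatorOne : ∀ {q k n} → Subset n → Array q k n → Set
IndicatorOne {q} {k} {n} Λ F =
  ∃ λ (w : Vec (Fin q) n) → ∀ (i : Fin k) → ¬ Covers Λ (lookup F i) w

covers? : ∀ {q n} (Λ : Subset n) row w → Dec (Covers {q} Λ row w)
covers? Λ row w = all? λ j → (j ∈? Λ) →-dec (lookup row j ≟ lookup w j)

vecAny? : ∀ {q} n {P : Vec (Fin q) n → Set} → (∀ v → Dec (P v)) → Dec (∃ P)
vecAny? zero P? = map′ (λ p → [] , p) (λ { ([] , p) → p }) (P? [])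
vecAny? (suc n) P? =
  map′ (λ { (x , v , p) → x ∷ v , p }) (λ { (x ∷ v , p) → x , v , p })
       (any? λ x → vecAny? n λ v → P? (x ∷ v))

indicatorOne? : ∀ {q k n} (Λ : Subset n) (F : Array q k n) → Dec (IndicatorOne Λ F)
indicatorOne? {n = n} Λ F = vecAny? n λ w → all? λ i → ¬? (covers? Λ (lookup F i) w)

bothOne? : ∀ {q k n} (Γ Δ : Subset n) (F : Array q k n) →
           Dec (IndicatorOne Γ F × IndicatorOne Δ F)
bothOne? Γ Δ F = indicatorOne? Γ F ×-dec indicatorOne? Δ F

allVecs : ∀ {A : Set} → List A → (m : ℕ) → List (Vec A m)
allVecs xs zero = [] List.∷ List.[]
allVecs xs (suc m) = concatMap (λ x → List.map (x ∷_) (allVecs xs m)) xs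

allArrays : ∀ q k n → List (Array q k n)
allArrays q k n = allVecs (allVecs (allFin q) n) k

countBoth : ∀ q k n → Subset n → Subset n → ℕ
countBoth q k n Γ Δ = length (filter (bothOne? Γ Δ) (allArrays q k n))

-- ℚ-valued helpers (the q = 0 clause is junk; the statement assumes q ≥ 2)
fromℕ : ℕ → ℚ
fromℕ m = + m / 1

divPow : ℕ → ℕ → ℕ → ℚ
divPow a zero e = 0ℚ
divPow a (suc q) e = (+ a / (suc q ^ e)) {{m^n≢0 (suc q) e}}

powℚ : ℚ → ℕ → ℚ
powℚ x zero = 1ℚ
powℚ x (suc m) = x ℚ.* powℚ x m

-- P(I_Γ I_Δ = 1) for a uniformly random k × n array over Fin q
probBoth : ∀ q k n → Subset n → Subset n → ℚ
probBoth q k n Γ Δ = divPow (countBoth q k n Γ Δ) q (k * n)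

boundMain : (q t r k : ℕ) → ℚ
boundMain q t r k =
  fromℕ (q ^ (2 * t ∸ r)) ℚ.*
  powℚ ((fromℕ (q ^ t) ℚ.+ divPow 1 q (t ∸ r) ℚ.- fromℕ 2) ℚ.* divPow 1 q t) k

module Submission where

-- If I_Γ = I_Δ = 1, some word w on Γ and some word v on Δ are missed by every
-- row.  Either w, v agree on Γ ∩ Δ, and then the word on Γ ∪ Δ gluing them is
-- missed (on Γ and on Δ) by every row, or they form a clashing pair.  A union
-- bound over the q^m words on Γ ∪ Δ (m = 2t - r) and the q^(2t) clashing pairs,
-- independence of the rows and inclusion–exclusion within one row give
--   #{F : I_Γ I_Δ = 1} ≤ q^m Nc^k + q^(2t) Ni^k,   Nc = Ni + q^(n-m),
-- with Nc, Ni the numbers of rows missing a compatible, resp. clashing, pair.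
-- Bernoulli's inequality makes the clash term a (d+1)-th of the main term once
-- k > (d+1) q^(2t), and Nc/q^n is exactly (q^t + q^(r-t) - 2)/q^t.  Module Combinatorics proves the integer estimate
-- for a fixed pair Γ, Δ; module Rationals supplies ℕ ↪ ℚ, negative powers of q
-- and the closed form of the bound; the last part combines them.

open import Defs

module Combinatorics where

  open import Data.Nat using (ℕ; zero; suc; _+_; _*_; _^_; _∸_; _≤_; z≤n; s≤s; NonZero)
  import Data.Nat.Properties as ℕP
  open import Data.List as List using (List; []; _∷_; _++_; map; concatMap; length; filter; allFin)
  import Data.List.Properties as ListP
  open import Data.List.Relation.Unary.Any as Any using (Any; here; there)
  open import Data.Product using (_×_; _,_; proj₁; proj₂)
  open import Data.Vec using (Vec; []; _∷_; lookup; here; there)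
  open import Data.Fin using (Fin; zero; suc)
  open import Data.Fin.Properties using (all?; _≟_; suc-injective)
  open import Data.Fin.Subset using (Subset; _∉_; _∪_; _∩_; ∣_∣)
  open import Data.Fin.Subset.Properties using (∣p∣≤n; ∣p∩q∣≤∣p∣; _∈?_; x∈p∩q⁺; x∈p∩q⁻; x∈p∪q⁻; p⊆p∪q; q⊆p∪q)
  open import Data.Bool using (true; false; if_then_else_)
  import Data.List.Relation.Unary.Any.Properties as AnyP
  open import Data.Unit using (⊤; tt)
  open import Data.Sum using (_⊎_; inj₁; inj₂; [_,_])
  open import Data.Empty using (⊥-elim)
  open import Relation.Nullary using (Dec; yes; no; ¬_; ¬?; _×-dec_)
  open import Relation.Binary.PropositionalEquality hiding ([_])
  open import Function using (_∘_)
  open import Data.Nat.Solver using (module +-*-Solver)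
  open +-*-Solver using (solve; _:+_; _:*_; _:=_; con)
  open import Algebra.Properties.CommutativeSemigroup ℕP.+-commutativeSemigroup
    using () renaming (interchange to +-interchange)

  private variable
    A B : Set
    P Q R : Set

  ^-∸-split : ∀ q {a n} → a ≤ n → q ^ (n ∸ a) * q ^ a ≡ q ^ n
  ^-∸-split q {a} {n} a≤n = trans (sym (ℕP.^-distribˡ-+-* q (n ∸ a) a)) (cong (q ^_) (ℕP.m∸n+n≡m a≤n))

  double-≤ : ∀ q {a n} → 2 ≤ q ^ a → a ≤ n → q ^ (n ∸ a) + q ^ (n ∸ a) ≤ q ^ n
  double-≤ q {a} {n} 2≤q^a a≤n = begin
    c + c          ≡⟨ cong (c +_) (ℕP.+-identityʳ c) ⟨
    2 * c          ≤⟨ ℕP.*-monoˡ-≤ c 2≤q^a ⟩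
    q ^ a * c      ≡⟨ trans (ℕP.*-comm (q ^ a) c) (^-∸-split q a≤n) ⟩
    q ^ n          ∎
    where
    open ℕP.≤-Reasoning
    c : ℕ
    c = q ^ (n ∸ a)

  bernoulli : ∀ b c j → b ^ j * (b + j * c) ≤ (b + c) ^ suc j
  bernoulli b c zero = begin
    1 * (b + 0 * c)   ≡⟨ solve 2 (λ b c → con 1 :* (b :+ con 0 :* c) := b) refl b c ⟩
    b                 ≤⟨ ℕP.m≤m+n b c ⟩
    b + c             ≡⟨ ℕP.*-identityʳ (b + c) ⟨
    (b + c) * 1       ∎
    where open ℕP.≤-Reasoning
  bernoulli b c (suc j) = begin
    b * X * (b + (c + j * c))
      ≡⟨ solve 4 (λ b c j X → b :* X :* (b :+ (c :+ j :* c)) := b :* (X :* (b :+ j :* c)) :+ X :* b :* c) refl b c j X ⟩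
    b * (X * (b + j * c)) + X * b * c
      ≤⟨ ℕP.+-monoʳ-≤ (b * (X * (b + j * c))) (ℕP.*-monoˡ-≤ c (ℕP.*-monoʳ-≤ X (ℕP.m≤m+n b (j * c)))) ⟩
    b * (X * (b + j * c)) + X * (b + j * c) * c
      ≡⟨ solve 4 (λ b c j X → b :* (X :* (b :+ j :* c)) :+ X :* (b :+ j :* c) :* c := (b :+ c) :* (X :* (b :+ j :* c))) refl b c j X ⟩
    (b + c) * (X * (b + j * c))
      ≤⟨ ℕP.*-monoʳ-≤ (b + c) (bernoulli b c j) ⟩
    (b + c) * (b + c) ^ suc j ∎
    where
    open ℕP.≤-Reasoning
    X : ℕ
    X = b ^ j

  tail-domination : ∀ {b c Q s j} → b ≤ c * Q → s ≤ j → s * b ^ suc j ≤ Q * (b + c) ^ suc j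
  tail-domination {b} {c} {Q} {s} {j} b≤cQ s≤j = begin
    s * (b * X)           ≤⟨ ℕP.*-monoʳ-≤ s (ℕP.*-monoˡ-≤ X b≤cQ) ⟩
    s * (c * Q * X)       ≤⟨ ℕP.*-monoˡ-≤ (c * Q * X) s≤j ⟩
    j * (c * Q * X)       ≡⟨ solve 4 (λ j c Q X → j :* (c :* Q :* X) := Q :* (X :* (j :* c))) refl j c Q X ⟩
    Q * (X * (j * c))     ≤⟨ ℕP.*-monoʳ-≤ Q (ℕP.*-monoʳ-≤ X (ℕP.m≤n+m (j * c) b)) ⟩
    Q * (X * (b + j * c)) ≤⟨ ℕP.*-monoʳ-≤ Q (bernoulli b c j) ⟩
    Q * (b + c) ^ suc j   ∎
    where
    open ℕP.≤-Reasoning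
    X : ℕ
    X = b ^ j

  sumOver : List A → (A → ℕ) → ℕ
  sumOver []       f = 0
  sumOver (x ∷ xs) f = f x + sumOver xs f

  syntax sumOver xs (λ x → e) = ∑[ x ← xs ] e

  ∑-cong : (xs : List A) {f g : A → ℕ} → (∀ x → f x ≡ g x) → ∑[ x ← xs ] f x ≡ ∑[ x ← xs ] g x
  ∑-cong []       f≡g = refl
  ∑-cong (x ∷ xs) f≡g = cong₂ _+_ (f≡g x) (∑-cong xs f≡g)

  ∑-mono : (xs : List A) {f g : A → ℕ} → (∀ x → f x ≤ g x) → ∑[ x ← xs ] f x ≤ ∑[ x ← xs ] g x
  ∑-mono []       f≤g = z≤n
  ∑-mono (x ∷ xs) f≤g = ℕP.+-mono-≤ (f≤g x) (∑-mono xs f≤g)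

  ∑-const : (xs : List A) (c : ℕ) → ∑[ x ← xs ] c ≡ length xs * c
  ∑-const []       c = refl
  ∑-const (x ∷ xs) c = cong (c +_) (∑-const xs c)

  ∑-+ : (xs : List A) (f g : A → ℕ) → ∑[ x ← xs ] (f x + g x) ≡ ∑[ x ← xs ] f x + ∑[ x ← xs ] g x
  ∑-+ []       f g = refl
  ∑-+ (x ∷ xs) f g =
    trans (cong (f x + g x +_) (∑-+ xs f g)) (+-interchange (f x) (g x) _ _)

  ∑-*ʳ : (xs : List A) (f : A → ℕ) (c : ℕ) → ∑[ x ← xs ] (f x * c) ≡ (∑[ x ← xs ] f x) * c
  ∑-*ʳ []       f c = refl
  ∑-*ʳ (x ∷ xs) f c =
    trans (cong (f x * c +_) (∑-*ʳ xs f c)) (sym (ℕP.*-distribʳ-+ c (f x) _))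

  ∑-++ : (xs ys : List A) (f : A → ℕ) → ∑[ x ← xs ++ ys ] f x ≡ ∑[ x ← xs ] f x + ∑[ x ← ys ] f x
  ∑-++ []       ys f = refl
  ∑-++ (x ∷ xs) ys f = trans (cong (f x +_) (∑-++ xs ys f)) (sym (ℕP.+-assoc (f x) _ _))

  ∑-map : (xs : List A) (g : A → B) (f : B → ℕ) → ∑[ y ← map g xs ] f y ≡ ∑[ x ← xs ] f (g x)
  ∑-map []       g f = refl
  ∑-map (x ∷ xs) g f = cong (f (g x) +_) (∑-map xs g f)

  ∑-concatMap : (xs : List A) (g : A → List B) (f : B → ℕ) →
                ∑[ y ← concatMap g xs ] f y ≡ ∑[ x ← xs ] ∑[ y ← g x ] f y
  ∑-concatMap []       g f = refl
  ∑-concatMap (x ∷ xs) g f = trans (∑-++ (g x) _ f) (cong (_ +_) (∑-concatMap xs g f))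

  ∑-swap : (xs : List A) (ys : List B) (f : A → B → ℕ) →
           ∑[ x ← xs ] ∑[ y ← ys ] f x y ≡ ∑[ y ← ys ] ∑[ x ← xs ] f x y
  ∑-swap []       ys f = sym (trans (∑-const ys 0) (ℕP.*-zeroʳ (length ys)))
  ∑-swap (x ∷ xs) ys f =
    trans (cong (∑[ y ← ys ] f x y +_) (∑-swap xs ys f)) (sym (∑-+ ys (f x) _))

  indicator : {P : Set} → Dec P → ℕ
  indicator (yes _) = 1
  indicator (no _)  = 0

  -- count P? xs: the number of entries of xs satisfying P.  Every counting
  -- fact below is a pointwise fact about indicators, summed over the list.
  count : {P : A → Set} → (∀ x → Dec (P x)) → List A → ℕ
  count P? xs = ∑[ x ← xs ] indicator (P? x)

  indicator-yes : P → (p : Dec P) → indicator p ≡ 1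
  indicator-yes x (yes _) = refl
  indicator-yes x (no ¬x) = ⊥-elim (¬x x)

  indicator-no : ¬ P → (p : Dec P) → indicator p ≡ 0
  indicator-no ¬x (yes x) = ⊥-elim (¬x x)
  indicator-no ¬x (no _)  = refl

  indicator-mono : (P → Q) → (p : Dec P) (q : Dec Q) → indicator p ≤ indicator q
  indicator-mono f (yes x) q = ℕP.≤-reflexive (sym (indicator-yes (f x) q))
  indicator-mono f (no _)  q = z≤n

  indicator-⊎ : (P → Q ⊎ R) → (p : Dec P) (q : Dec Q) (r : Dec R) →
                indicator p ≤ indicator q + indicator r
  indicator-⊎ f (no _)  q       r = z≤n
  indicator-⊎ f (yes x) (yes _) r = s≤s z≤n
  indicator-⊎ f (yes x) (no ¬y) r with f x
  ... | inj₁ y = ⊥-elim (¬y y)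
  ... | inj₂ z = ℕP.≤-reflexive (sym (indicator-yes z r))

  indicator-incl-excl : (p : Dec P) (q : Dec Q) →
    indicator (¬? p ×-dec ¬? q) + indicator p + indicator q ≡ 1 + indicator (p ×-dec q)
  indicator-incl-excl (yes _) (yes _) = refl
  indicator-incl-excl (yes _) (no _)  = refl
  indicator-incl-excl (no _)  (yes _) = refl
  indicator-incl-excl (no _)  (no _)  = refl

  indicator-any : {P : Set} {Q : B → Set} (W : List B) (Q? : ∀ w → Dec (Q w)) →
                  (P → Any Q W) → (p : Dec P) → indicator p ≤ ∑[ w ← W ] indicator (Q? w)
  indicator-any W Q? f (no _) = z≤n
  indicator-any {Q = Q} W Q? f (yes x) = at-least-one W (f x)
    where
    at-least-one : ∀ W → Any Q W → 1 ≤ ∑[ w ← W ] indicator (Q? w)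
    at-least-one (w ∷ W) (here y)  = ℕP.≤-trans (ℕP.≤-reflexive (sym (indicator-yes y (Q? w)))) (ℕP.m≤m+n _ _)
    at-least-one (w ∷ W) (there y) = ℕP.≤-trans (at-least-one W y) (ℕP.m≤n+m _ _)

  module _ {P : A → Set} (P? : ∀ x → Dec (P x)) where

    count-filter : ∀ xs → length (filter P? xs) ≡ count P? xs
    count-filter []       = refl
    count-filter (x ∷ xs) with P? x
    ... | yes _ = cong suc (count-filter xs)
    ... | no _  = count-filter xs

    count-none : (∀ x → ¬ P x) → ∀ xs → count P? xs ≡ 0
    count-none ¬P xs = begin
      count P? xs             ≡⟨ ∑-cong xs (λ x → indicator-no (¬P x) (P? x)) ⟩
      ∑[ x ← xs ] 0           ≡⟨ ∑-const xs 0 ⟩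
      length xs * 0           ≡⟨ ℕP.*-zeroʳ (length xs) ⟩
      0                       ∎
      where open ≡-Reasoning

    count-all : (∀ x → P x) → ∀ xs → count P? xs ≡ length xs
    count-all all xs = begin
      count P? xs             ≡⟨ ∑-cong xs (λ x → indicator-yes (all x) (P? x)) ⟩
      ∑[ x ← xs ] 1           ≡⟨ ∑-const xs 1 ⟩
      length xs * 1           ≡⟨ ℕP.*-identityʳ (length xs) ⟩
      length xs               ∎
      where open ≡-Reasoning

    count-mono : {Q : A → Set} (Q? : ∀ x → Dec (Q x)) → (∀ x → P x → Q x) → ∀ xs → count P? xs ≤ count Q? xs
    count-mono Q? f xs = ∑-mono xs (λ x → indicator-mono (f x) (P? x) (Q? x))

  count-cong : {P Q : A → Set} (P? : ∀ x → Dec (P x)) (Q? : ∀ x → Dec (Q x)) →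
               (∀ x → P x → Q x) → (∀ x → Q x → P x) → ∀ xs → count P? xs ≡ count Q? xs
  count-cong P? Q? f g xs = ℕP.≤-antisym (count-mono P? Q? f xs) (count-mono Q? P? g xs)

  count-⊎ : {P Q R : A → Set} (P? : ∀ x → Dec (P x)) (Q? : ∀ x → Dec (Q x)) (R? : ∀ x → Dec (R x)) →
            (∀ x → P x → Q x ⊎ R x) → ∀ xs → count P? xs ≤ count Q? xs + count R? xs
  count-⊎ P? Q? R? f xs = ℕP.≤-trans (∑-mono xs (λ x → indicator-⊎ (f x) (P? x) (Q? x) (R? x)))
                                      (ℕP.≤-reflexive (∑-+ xs _ _))

  count-any : {P : A → Set} {Q : B → A → Set} (P? : ∀ x → Dec (P x)) (W : List B)
              (Q? : ∀ w x → Dec (Q w x)) → (∀ x → P x → Any (λ w → Q w x) W) →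
              ∀ xs → count P? xs ≤ ∑[ w ← W ] count (Q? w) xs
  count-any P? W Q? f xs =
    ℕP.≤-trans (∑-mono xs (λ x → indicator-any W (λ w → Q? w x) (f x) (P? x)))
               (ℕP.≤-reflexive (∑-swap xs W _))

  count-incl-excl : {P Q : A → Set} (P? : ∀ x → Dec (P x)) (Q? : ∀ x → Dec (Q x)) → ∀ xs →
    count (λ x → ¬? (P? x) ×-dec ¬? (Q? x)) xs + count P? xs + count Q? xs
      ≡ length xs + count (λ x → P? x ×-dec Q? x) xs
  count-incl-excl {A = A} P? Q? xs = begin
    ∑[ x ← xs ] n x + ∑[ x ← xs ] p x + ∑[ x ← xs ] q x ≡⟨ cong (_+ ∑[ x ← xs ] q x) (∑-+ xs n p) ⟨
    ∑[ x ← xs ] (n x + p x) + ∑[ x ← xs ] q x           ≡⟨ ∑-+ xs (λ x → n x + p x) q ⟨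
    ∑[ x ← xs ] (n x + p x + q x)                       ≡⟨ ∑-cong xs (λ x → indicator-incl-excl (P? x) (Q? x)) ⟩
    ∑[ x ← xs ] (1 + r x)                               ≡⟨ ∑-+ xs (λ _ → 1) r ⟩
    ∑[ x ← xs ] 1 + ∑[ x ← xs ] r x                     ≡⟨ cong (_+ ∑[ x ← xs ] r x) (trans (∑-const xs 1) (ℕP.*-identityʳ _)) ⟩
    length xs + ∑[ x ← xs ] r x                         ∎
    where
    open ≡-Reasoning
    n p q r : A → ℕ
    n x = indicator (¬? (P? x) ×-dec ¬? (Q? x))
    p x = indicator (P? x)
    q x = indicator (Q? x)
    r x = indicator (P? x ×-dec Q? x)

  Every : (A → Set) → ∀ {k} → Vec A k → Set
  Every P F = ∀ i → P (lookup F i)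

  every? : {P : A → Set} → (∀ x → Dec (P x)) → ∀ {k} (F : Vec A k) → Dec (Every P F)
  every? P? F = all? (λ i → P? (lookup F i))

  count-allVecs-∷ : ∀ {n} {P : Vec A (suc n) → Set} {C : A → Set} {R : Vec A n → Set}
    (P? : ∀ v → Dec (P v)) (C? : ∀ z → Dec (C z)) (R? : ∀ v → Dec (R v)) (L : List A) →
    (∀ z v → P (z ∷ v) → C z × R v) → (∀ z v → C z → R v → P (z ∷ v)) →
    count P? (allVecs L (suc n)) ≡ count C? L * count R? (allVecs L n)
  count-allVecs-∷ {n = n} P? C? R? L split join = begin
    count P? (allVecs L (suc n))                          ≡⟨ ∑-concatMap L (λ z → map (z ∷_) (allVecs L n)) _ ⟩
    ∑[ z ← L ] count P? (map (z ∷_) (allVecs L n))        ≡⟨ ∑-cong L (λ z → trans (∑-map (allVecs L n) (z ∷_) _) (fibre z)) ⟩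
    ∑[ z ← L ] (indicator (C? z) * count R? (allVecs L n)) ≡⟨ ∑-*ʳ L (λ z → indicator (C? z)) _ ⟩
    count C? L * count R? (allVecs L n)                   ∎
    where
    open ≡-Reasoning
    fibre : ∀ z → count (λ v → P? (z ∷ v)) (allVecs L n) ≡ indicator (C? z) * count R? (allVecs L n)
    fibre z with C? z
    ... | yes c = trans (count-cong (λ v → P? (z ∷ v)) R? (λ v h → proj₂ (split z v h)) (λ v → join z v c) (allVecs L n))
                        (sym (ℕP.+-identityʳ _))
    ... | no ¬c = count-none (λ v → P? (z ∷ v)) (λ v h → ¬c (proj₁ (split z v h))) (allVecs L n)

  count-every : {P : A → Set} (P? : ∀ x → Dec (P x)) (L : List A) (k : ℕ) →
                count (every? P?) (allVecs L k) ≡ count P? L ^ k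
  count-every P? L zero    = count-all (every? P?) (λ _ ()) (allVecs L zero)
  count-every P? L (suc k) =
    trans (count-allVecs-∷ (every? P?) P? (every? P?) L
                           (λ z v all → all zero , all ∘ suc)
                           (λ z v p all → λ { zero → p ; (suc i) → all i }))
          (cong (count P? L *_) (count-every P? L k))

  length-allVecs : (L : List A) (k : ℕ) → length (allVecs L k) ≡ length L ^ k
  length-allVecs {A = A} L k = begin
    length (allVecs L k)                      ≡⟨ count-all trivial? (λ _ _ → tt) (allVecs L k) ⟨
    count trivial? (allVecs L k)              ≡⟨ count-every always? L k ⟩
    count always? L ^ k                       ≡⟨ cong (_^ k) (count-all always? (λ _ → tt) L) ⟩
    length L ^ k                              ∎
    where
    open ≡-Reasoning
    always? : (x : A) → Dec ⊤
    always? _ = yes tt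
    trivial? : (v : Vec A k) → Dec (Every (λ _ → ⊤) v)
    trivial? = every? always?

  length-concatMap : (f : A → List B) (xs : List A) → length (concatMap f xs) ≡ ∑[ x ← xs ] length (f x)
  length-concatMap f []       = refl
  length-concatMap f (x ∷ xs) = trans (ListP.length-++ (f x)) (cong (length (f x) +_) (length-concatMap f xs))

  ∑-allFin-suc : ∀ {q} (f : Fin (suc q) → ℕ) →
                 ∑[ z ← allFin (suc q) ] f z ≡ f zero + ∑[ z ← allFin q ] f (suc z)
  ∑-allFin-suc {q} f = cong (f zero +_) (begin
    ∑[ z ← List.tabulate suc ] f z         ≡⟨ cong (λ zs → ∑[ z ← zs ] f z) (ListP.map-tabulate (λ z → z) suc) ⟨
    ∑[ z ← map suc (allFin q) ] f z        ≡⟨ ∑-map (allFin q) suc f ⟩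
    ∑[ z ← allFin q ] f (suc z)            ∎)
    where open ≡-Reasoning

  length-allFin : ∀ q → length (allFin q) ≡ q
  length-allFin q = ListP.length-tabulate (λ z → z)

  count-≟ : ∀ {q} (x : Fin q) → count (_≟ x) (allFin q) ≡ 1
  count-≟ {suc q} zero    = trans (∑-allFin-suc {q} (λ z → indicator (z ≟ zero)))
                                  (cong suc (count-none (λ z → suc z ≟ zero) (λ z ()) (allFin q)))
  count-≟ {suc q} (suc x) = begin
    count (_≟ suc x) (allFin (suc q))     ≡⟨ ∑-allFin-suc {q} (λ z → indicator (z ≟ suc x)) ⟩
    count (λ z → suc z ≟ suc x) (allFin q) ≡⟨ count-cong _ (_≟ x) (λ z → suc-injective) (λ z → cong suc) (allFin q) ⟩
    count (_≟ x) (allFin q)               ≡⟨ count-≟ x ⟩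
    1                                     ∎
    where open ≡-Reasoning

  -- Rows of length n over the alphabet Fin q.  A word on a column set Λ is
  -- represented by any row carrying it on Λ, and  Covers Λ u w  says that the
  -- rows u and w agree on Λ.
  rows : (q n : ℕ) → List (Vec (Fin q) n)
  rows q n = allVecs (allFin q) n

  length-rows : ∀ q n → length (rows q n) ≡ q ^ n
  length-rows q n = trans (length-allVecs (allFin q) n) (cong (_^ n) (length-allFin q))

  module _ {q n : ℕ} where

    covers-tail : ∀ {b} {Λ : Subset n} {z x : Fin q} {u w} → Covers (b ∷ Λ) (z ∷ u) (x ∷ w) → Covers Λ u w
    covers-tail c j j∈Λ = c (suc j) (there j∈Λ)

    covers-∷ : ∀ {b} {Λ : Subset n} {z x : Fin q} {u w} →
               (b ≡ true → z ≡ x) → Covers Λ u w → Covers (b ∷ Λ) (z ∷ u) (x ∷ w)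
    covers-∷ h c zero    here          = h refl
    covers-∷ h c (suc j) (there j∈Λ)   = c j j∈Λ

  -- A row is free outside Λ: exactly q^(n-|Λ|) rows carry a given word on Λ.
  count-covers : ∀ {q n} (Λ : Subset n) (w : Vec (Fin q) n) →
                 count (λ row → covers? Λ row w) (rows q n) * q ^ ∣ Λ ∣ ≡ q ^ n
  count-covers {q} [] [] = cong (_* 1) (count-all (λ row → covers? [] row []) (λ _ _ ()) (rows q 0))
  count-covers {q} {suc n} (true ∷ Λ) (x ∷ w) = begin
    count (λ row → covers? (true ∷ Λ) row (x ∷ w)) (rows q (suc n)) * (q * q ^ ∣ Λ ∣)
      ≡⟨ cong (_* (q * q ^ ∣ Λ ∣)) (count-allVecs-∷ _ (_≟ x) (λ row → covers? Λ row w) (allFin q)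
                                       (λ z v c → c zero here , covers-tail c)
                                       (λ z v z≡x c → covers-∷ (λ _ → z≡x) c)) ⟩
    count (_≟ x) (allFin q) * c * (q * q ^ ∣ Λ ∣)   ≡⟨ cong (λ m → m * c * (q * q ^ ∣ Λ ∣)) (count-≟ x) ⟩
    1 * c * (q * q ^ ∣ Λ ∣)                         ≡⟨ solve 3 (λ c q Q → con 1 :* c :* (q :* Q) := q :* (c :* Q)) refl c q (q ^ ∣ Λ ∣) ⟩
    q * (c * q ^ ∣ Λ ∣)                             ≡⟨ cong (q *_) (count-covers Λ w) ⟩
    q * q ^ n                                       ∎
    where
    open ≡-Reasoning
    c : ℕ
    c = count (λ row → covers? Λ row w) (rows q n)
  count-covers {q} {suc n} (false ∷ Λ) (x ∷ w) = begin
    count (λ row → covers? (false ∷ Λ) row (x ∷ w)) (rows q (suc n)) * q ^ ∣ Λ ∣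
      ≡⟨ cong (_* q ^ ∣ Λ ∣) (count-allVecs-∷ _ always? (λ row → covers? Λ row w) (allFin q)
                                 (λ z v c → tt , covers-tail c)
                                 (λ z v _ c → covers-∷ (λ ()) c)) ⟩
    count always? (allFin q) * c * q ^ ∣ Λ ∣         ≡⟨ cong (λ m → m * c * q ^ ∣ Λ ∣) (trans (count-all always? (λ _ → tt) (allFin q)) (length-allFin q)) ⟩
    q * c * q ^ ∣ Λ ∣                               ≡⟨ ℕP.*-assoc q c _ ⟩
    q * (c * q ^ ∣ Λ ∣)                             ≡⟨ cong (q *_) (count-covers Λ w) ⟩
    q * q ^ n                                       ∎
    where
    open ≡-Reasoning
    c : ℕ
    c = count (λ row → covers? Λ row w) (rows q n)
    always? : (z : Fin q) → Dec ⊤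
    always? _ = yes tt

  count-covers-exact : ∀ {q n} .{{_ : NonZero q}} (Λ : Subset n) (w : Vec (Fin q) n) →
                       count (λ row → covers? Λ row w) (rows q n) ≡ q ^ (n ∸ ∣ Λ ∣)
  count-covers-exact {q} Λ w = ℕP.*-cancelʳ-≡ _ _ (q ^ ∣ Λ ∣) {{ℕP.m^n≢0 q ∣ Λ ∣}}
    (trans (count-covers Λ w) (sym (^-∸-split q (∣p∣≤n Λ))))

  -- A complete list of the words on Λ: one row per word, namely the row that
  -- carries it on Λ and is zero off Λ.
  words : ∀ {q n} → Subset n → List (Vec (Fin (suc q)) n)
  words     []          = [] ∷ []
  words {q} (true ∷ Λ)  = concatMap (λ x → map (x ∷_) (words Λ)) (allFin (suc q))
  words     (false ∷ Λ) = map (zero ∷_) (words Λ)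

  length-words : ∀ {q n} (Λ : Subset n) → length (words {q} Λ) ≡ suc q ^ ∣ Λ ∣
  length-words     []          = refl
  length-words {q} (true ∷ Λ)  = begin
    length (concatMap (λ x → map (x ∷_) (words Λ)) (allFin (suc q)))
      ≡⟨ length-concatMap (λ x → map (x ∷_) (words Λ)) (allFin (suc q)) ⟩
    ∑[ x ← allFin (suc q) ] length (map (x ∷_) (words Λ))
      ≡⟨ ∑-cong (allFin (suc q)) (λ x → trans (ListP.length-map (x ∷_) (words Λ)) (length-words Λ)) ⟩
    ∑[ x ← allFin (suc q) ] (suc q ^ ∣ Λ ∣)
      ≡⟨ trans (∑-const (allFin (suc q)) _) (cong (_* suc q ^ ∣ Λ ∣) (length-allFin (suc q))) ⟩
    suc q * suc q ^ ∣ Λ ∣ ∎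
    where open ≡-Reasoning
  length-words     (false ∷ Λ) = trans (ListP.length-map (zero ∷_) (words Λ)) (length-words Λ)

  represent : ∀ {q n} (Λ : Subset n) (w : Vec (Fin (suc q)) n) → Any (λ u → Covers Λ u w) (words Λ)
  represent []          []      = here (λ ())
  represent (true ∷ Λ)  (x ∷ w) = AnyP.concat⁺ (AnyP.map⁺ (AnyP.tabulate⁺ {f = λ z → z} x
                                    (AnyP.map⁺ (Any.map (covers-∷ (λ _ → refl)) (represent Λ w)))))
  represent (false ∷ Λ) (x ∷ w) = AnyP.map⁺ (Any.map (covers-∷ (λ ())) (represent Λ w))

  glue : ∀ {q n} → Subset n → Vec (Fin q) n → Vec (Fin q) n → Vec (Fin q) n
  glue []      []      []      = []
  glue (b ∷ Γ) (x ∷ w) (y ∷ v) = (if b then x else y) ∷ glue Γ w v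

  module _ {q : ℕ} where

    glue-covers-left : ∀ {n} (Γ : Subset n) (w v : Vec (Fin q) n) → Covers Γ (glue Γ w v) w
    glue-covers-left []          []      []      = λ _ ()
    glue-covers-left (true ∷ Γ)  (x ∷ w) (y ∷ v) = covers-∷ (λ _ → refl) (glue-covers-left Γ w v)
    glue-covers-left (false ∷ Γ) (x ∷ w) (y ∷ v) = covers-∷ (λ ()) (glue-covers-left Γ w v)

    glue-outside : ∀ {n} (Γ : Subset n) (w v : Vec (Fin q) n) j → j ∉ Γ → lookup (glue Γ w v) j ≡ lookup v j
    glue-outside (true ∷ Γ)  (x ∷ w) (y ∷ v) zero    j∉Γ = ⊥-elim (j∉Γ here)
    glue-outside (false ∷ Γ) (x ∷ w) (y ∷ v) zero    j∉Γ = refl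
    glue-outside (b ∷ Γ)     (x ∷ w) (y ∷ v) (suc j) j∉Γ = glue-outside Γ w v j (λ j∈Γ → j∉Γ (there j∈Γ))

    glue-covers-right : ∀ {n} (Γ Δ : Subset n) (w v : Vec (Fin q) n) →
                        Covers (Γ ∩ Δ) w v → Covers Δ (glue Γ w v) v
    glue-covers-right Γ Δ w v c j j∈Δ with j ∈? Γ
    ... | yes j∈Γ = trans (glue-covers-left Γ w v j j∈Γ) (c j (x∈p∩q⁺ (j∈Γ , j∈Δ)))
    ... | no  j∉Γ = glue-outside Γ w v j j∉Γ

  misses-transfer : ∀ {q n} {Λ : Subset n} (row u w : Vec (Fin q) n) →
                    Covers Λ u w → ¬ Covers Λ row w → ¬ Covers Λ row u
  misses-transfer row u w u≈w misses-w covers-u = misses-w (λ j j∈Λ → trans (covers-u j j∈Λ) (u≈w j j∈Λ))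

  module ColumnPair (q′ n : ℕ) (Γ Δ : Subset n) where

    q : ℕ
    q = suc q′

    Row : Set
    Row = Vec (Fin q) n

    Misses : Row → Row → Row → Set
    Misses w v row = ¬ Covers Γ row w × ¬ Covers Δ row v

    misses? : (w v row : Row) → Dec (Misses w v row)
    misses? w v row = ¬? (covers? Γ row w) ×-dec ¬? (covers? Δ row v)

    -- Words w on Γ and v on Δ are compatible when they agree on Γ ∩ Δ,
    -- i.e. when a single row can carry both.
    Compatible : Row → Row → Set
    Compatible w v = Covers (Γ ∩ Δ) w v

    Clash : ∀ {k} → Row → Row → Array q k n → Set
    Clash w v F = ¬ Compatible w v × Every (Misses w v) F

    clash? : ∀ {k} (w v : Row) (F : Array q k n) → Dec (Clash w v F)
    clash? w v F = ¬? (covers? (Γ ∩ Δ) w v) ×-dec every? (misses? w v) F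

    -- I_Γ = I_Δ = 1 means a word w on Γ and a word v on Δ are both missed.
    -- If they are compatible, the single word on Γ ∪ Δ gluing them is missed
    -- on Γ and on Δ; otherwise their representatives form a clash.
    both-missed : ∀ {k} (F : Array q k n) → IndicatorOne Γ F × IndicatorOne Δ F →
                  Any (λ u → Every (Misses u u) F) (words (Γ ∪ Δ))
                  ⊎ Any (λ w → Any (λ v → Clash w v F) (words Δ)) (words Γ)
    both-missed F ((w , misses-w) , (v , misses-v)) with covers? (Γ ∩ Δ) w v
    ... | yes compatible = inj₁ (Any.map (λ {u} → missed u) (represent (Γ ∪ Δ) g))
      where
      g : Row
      g = glue Γ w v
      missed : ∀ u → Covers (Γ ∪ Δ) u g → Every (Misses u u) F
      missed u u≈g i = misses-transfer (lookup F i) u w u≈w (misses-w i)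
                     , misses-transfer (lookup F i) u v u≈v (misses-v i)
        where
        u≈w : Covers Γ u w
        u≈w j j∈Γ = trans (u≈g j (p⊆p∪q Δ j∈Γ)) (glue-covers-left Γ w v j j∈Γ)
        u≈v : Covers Δ u v
        u≈v j j∈Δ = trans (u≈g j (q⊆p∪q Γ Δ j∈Δ)) (glue-covers-right Γ Δ w v compatible j j∈Δ)
    ... | no incompatible =
      inj₂ (Any.map (λ {w′} w′≈w → Any.map (λ {v′} → clash w′ v′ w′≈w) (represent Δ v)) (represent Γ w))
      where
      clash : ∀ w′ v′ → Covers Γ w′ w → Covers Δ v′ v → Clash w′ v′ F
      clash w′ v′ w′≈w v′≈v =
          (λ w′≈v′ → incompatible (λ j j∈Γ∩Δ → let (j∈Γ , j∈Δ) = x∈p∩q⁻ Γ Δ j∈Γ∩Δ in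
                       trans (sym (w′≈w j j∈Γ)) (trans (w′≈v′ j j∈Γ∩Δ) (v′≈v j j∈Δ))))
        , (λ i → misses-transfer (lookup F i) w′ w w′≈w (misses-w i)
               , misses-transfer (lookup F i) v′ v v′≈v (misses-v i))

    MissedOnUnion : ∀ {k} → Array q k n → Set
    MissedOnUnion F = Any (λ u → Every (Misses u u) F) (words (Γ ∪ Δ))

    HasClash : ∀ {k} → Array q k n → Set
    HasClash F = Any (λ w → Any (λ v → Clash w v F) (words Δ)) (words Γ)

    count-both-≤ : ∀ k → countBoth q k n Γ Δ ≤
        ∑[ u ← words (Γ ∪ Δ) ] count (every? (misses? u u)) (allArrays q k n)
      + ∑[ w ← words Γ ] ∑[ v ← words Δ ] count (clash? w v) (allArrays q k n)
    count-both-≤ k = begin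
      countBoth q k n Γ Δ                              ≡⟨ count-filter (bothOne? Γ Δ) arrays ⟩
      count (bothOne? Γ Δ) arrays                      ≤⟨ count-⊎ (bothOne? Γ Δ) union? clash-any? both-missed arrays ⟩
      count union? arrays + count clash-any? arrays    ≤⟨ ℕP.+-mono-≤ union-bound clash-bound ⟩
      ∑[ u ← words (Γ ∪ Δ) ] count (every? (misses? u u)) arrays
        + ∑[ w ← words Γ ] ∑[ v ← words Δ ] count (clash? w v) arrays ∎
      where
      open ℕP.≤-Reasoning
      arrays : List (Array q k n)
      arrays = allArrays q k n
      union? : ∀ F → Dec (MissedOnUnion F)
      union? F = Any.any? (λ u → every? (misses? u u) F) (words (Γ ∪ Δ))
      clash-any? : ∀ F → Dec (HasClash F)
      clash-any? F = Any.any? (λ w → Any.any? (λ v → clash? w v F) (words Δ)) (words Γ)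
      union-bound : count union? arrays ≤ ∑[ u ← words (Γ ∪ Δ) ] count (every? (misses? u u)) arrays
      union-bound = count-any union? (words (Γ ∪ Δ)) (λ u → every? (misses? u u)) (λ F h → h) arrays
      clash-bound : count clash-any? arrays ≤ ∑[ w ← words Γ ] ∑[ v ← words Δ ] count (clash? w v) arrays
      clash-bound = ℕP.≤-trans
        (count-any clash-any? (words Γ) (λ w F → Any.any? (λ v → clash? w v F) (words Δ)) (λ F h → h) arrays)
        (∑-mono (words Γ) (λ w → count-any _ (words Δ) (clash? w) (λ F h → h) arrays))

    -- Rows carrying a given word on Γ, on Δ, and on Γ ∪ Δ, respectively.
    cΓ cΔ cΓ∪Δ : ℕ
    cΓ   = q ^ (n ∸ ∣ Γ ∣)
    cΔ   = q ^ (n ∸ ∣ Δ ∣)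
    cΓ∪Δ = q ^ (n ∸ ∣ Γ ∪ Δ ∣)

    -- Rows missing a compatible pair (in particular u, u), resp. a clashing pair.
    Ncompat Nclash : ℕ
    Ncompat = (q ^ n + cΓ∪Δ) ∸ (cΓ + cΔ)
    Nclash  = q ^ n ∸ (cΓ + cΔ)

    carries? : (w v row : Row) → Dec (Covers Γ row w × Covers Δ row v)
    carries? w v row = covers? Γ row w ×-dec covers? Δ row v

    count-misses : (w v : Row) → count (misses? w v) (rows q n) + (cΓ + cΔ) ≡ q ^ n + count (carries? w v) (rows q n)
    count-misses w v = begin
      #miss + (cΓ + cΔ)          ≡⟨ cong₂ (λ a b → #miss + (a + b)) (count-covers-exact Γ w) (count-covers-exact Δ v) ⟨
      #miss + (#onΓ + #onΔ)      ≡⟨ ℕP.+-assoc #miss #onΓ #onΔ ⟨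
      #miss + #onΓ + #onΔ        ≡⟨ count-incl-excl (λ row → covers? Γ row w) (λ row → covers? Δ row v) (rows q n) ⟩
      length (rows q n) + #both  ≡⟨ cong (_+ #both) (length-rows q n) ⟩
      q ^ n + #both              ∎
      where
      open ≡-Reasoning
      #miss #onΓ #onΔ #both : ℕ
      #miss = count (misses? w v) (rows q n)
      #onΓ  = count (λ row → covers? Γ row w) (rows q n)
      #onΔ  = count (λ row → covers? Δ row v) (rows q n)
      #both = count (carries? w v) (rows q n)

    rows-missing : (w v : Row) → count (misses? w v) (rows q n) ≡ q ^ n + count (carries? w v) (rows q n) ∸ (cΓ + cΔ)
    rows-missing w v = trans (sym (ℕP.m+n∸n≡m _ (cΓ + cΔ))) (cong (_∸ (cΓ + cΔ)) (count-misses w v))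

    -- The rows carrying u on Γ and on Δ are those carrying it on Γ ∪ Δ.
    rows-missing-union : (u : Row) → count (misses? u u) (rows q n) ≡ Ncompat
    rows-missing-union u = trans (rows-missing u u) (cong (λ c → q ^ n + c ∸ (cΓ + cΔ)) carried)
      where
      carried : count (carries? u u) (rows q n) ≡ cΓ∪Δ
      carried = trans (count-cong (carries? u u) (λ row → covers? (Γ ∪ Δ) row u)
                         (λ row (onΓ , onΔ) j j∈Γ∪Δ → [ onΓ j , onΔ j ] (x∈p∪q⁻ Γ Δ j∈Γ∪Δ))
                         (λ row on → (λ j j∈Γ → on j (p⊆p∪q Δ j∈Γ)) , (λ j j∈Δ → on j (q⊆p∪q Γ Δ j∈Δ)))
                         (rows q n))
                      (count-covers-exact (Γ ∪ Δ) u)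

    -- No row carries an incompatible pair.
    rows-missing-clash : (w v : Row) → ¬ Compatible w v → count (misses? w v) (rows q n) ≡ Nclash
    rows-missing-clash w v incompatible =
      trans (rows-missing w v) (cong (_∸ (cΓ + cΔ)) (trans (cong (q ^ n +_) carried) (ℕP.+-identityʳ (q ^ n))))
      where
      carried : count (carries? w v) (rows q n) ≡ 0
      carried = count-none (carries? w v)
        (λ row (onΓ , onΔ) → incompatible (λ j j∈Γ∩Δ → let (j∈Γ , j∈Δ) = x∈p∩q⁻ Γ Δ j∈Γ∩Δ in
                                              trans (sym (onΓ j j∈Γ)) (onΔ j j∈Δ)))
        (rows q n)

    -- The main term: arrays in which every row misses a fixed word on Γ and on Δ.
    main-term : ℕ → ℕ
    main-term k = q ^ ∣ Γ ∪ Δ ∣ * Ncompat ^ k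

    -- The union bound, with every term evaluated: rows are independent, so an
    -- array event "every row misses" has probability (row count)^k.
    count-both-bound : ∀ k → countBoth q k n Γ Δ ≤ main-term k + q ^ ∣ Γ ∣ * (q ^ ∣ Δ ∣ * Nclash ^ k)
    count-both-bound k = ℕP.≤-trans (count-both-≤ k) (ℕP.+-mono-≤ (ℕP.≤-reflexive union-sum) clash-sum)
      where
      arrays : List (Array q k n)
      arrays = allArrays q k n

      union-sum : ∑[ u ← words (Γ ∪ Δ) ] count (every? (misses? u u)) arrays ≡ main-term k
      union-sum = trans (∑-cong (words (Γ ∪ Δ)) (λ u → trans (count-every (misses? u u) (rows q n) k)
                                                             (cong (_^ k) (rows-missing-union u))))
                        (trans (∑-const (words (Γ ∪ Δ)) _) (cong (_* Ncompat ^ k) (length-words (Γ ∪ Δ))))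

      clash-count : ∀ w v → count (clash? w v) arrays ≤ Nclash ^ k
      clash-count w v = by-compatibility (covers? (Γ ∩ Δ) w v)
        where
        open ≡-Reasoning
        by-compatibility : Dec (Compatible w v) → count (clash? w v) arrays ≤ Nclash ^ k
        by-compatibility (yes compatible) =
          ℕP.≤-trans (ℕP.≤-reflexive (count-none (clash? w v) (λ F c → proj₁ c compatible) arrays)) z≤n
        by-compatibility (no incompatible) = ℕP.≤-reflexive (begin
          count (clash? w v) arrays              ≡⟨ count-cong (clash? w v) (every? (misses? w v)) (λ F → proj₂) (λ F e → incompatible , e) arrays ⟩
          count (every? (misses? w v)) arrays    ≡⟨ count-every (misses? w v) (rows q n) k ⟩
          count (misses? w v) (rows q n) ^ k     ≡⟨ cong (_^ k) (rows-missing-clash w v incompatible) ⟩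
          Nclash ^ k                             ∎)

      clash-sum : ∑[ w ← words Γ ] ∑[ v ← words Δ ] count (clash? w v) arrays ≤ q ^ ∣ Γ ∣ * (q ^ ∣ Δ ∣ * Nclash ^ k)
      clash-sum = ℕP.≤-trans (∑-mono (words Γ) (λ w → ∑-mono (words Δ) (clash-count w)))
        (ℕP.≤-reflexive (trans (∑-cong (words Γ) (λ _ → trans (∑-const (words Δ) _) (cong (_* Nclash ^ k) (length-words Δ))))
                               (trans (∑-const (words Γ) _) (cong (_* (q ^ ∣ Δ ∣ * Nclash ^ k)) (length-words Γ)))))

    Ncompat≡Nclash+cΓ∪Δ : cΓ + cΔ ≤ q ^ n → Ncompat ≡ Nclash + cΓ∪Δ
    Ncompat≡Nclash+cΓ∪Δ small = ℕP.+-∸-comm cΓ∪Δ small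

    Ncompat-balance : cΓ + cΔ ≤ q ^ n → Ncompat + (cΓ + cΔ) ≡ q ^ n + cΓ∪Δ
    Ncompat-balance small = ℕP.m∸n+n≡m (ℕP.≤-trans small (ℕP.m≤m+n (q ^ n) cΓ∪Δ))

    Nclash≤ : Nclash ≤ cΓ∪Δ * q ^ ∣ Γ ∪ Δ ∣
    Nclash≤ = ℕP.≤-trans (ℕP.m∸n≤m (q ^ n) (cΓ + cΔ)) (ℕP.≤-reflexive (sym (^-∸-split q (∣p∣≤n (Γ ∪ Δ)))))

    count-both-relative : ∀ d j → cΓ + cΔ ≤ q ^ n → suc d * (q ^ ∣ Γ ∣ * q ^ ∣ Δ ∣) ≤ j →
                          suc d * countBoth q (suc j) n Γ Δ ≤ suc d * main-term (suc j) + main-term (suc j)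
    count-both-relative d j small enough = begin
      suc d * countBoth q k n Γ Δ                   ≤⟨ ℕP.*-monoʳ-≤ (suc d) (count-both-bound k) ⟩
      suc d * (main-term k + clash-term)            ≡⟨ ℕP.*-distribˡ-+ (suc d) (main-term k) clash-term ⟩
      suc d * main-term k + suc d * clash-term      ≤⟨ ℕP.+-monoʳ-≤ (suc d * main-term k) clash-small ⟩
      suc d * main-term k + main-term k             ∎
      where
      open ℕP.≤-Reasoning
      k clash-term : ℕ
      k = suc j
      clash-term = q ^ ∣ Γ ∣ * (q ^ ∣ Δ ∣ * Nclash ^ k)
      clash-small : suc d * clash-term ≤ main-term k
      clash-small = begin
        suc d * clash-term                                  ≡⟨ solve 4 (λ d a b X → d :* (a :* (b :* X)) := d :* (a :* b) :* X)
                                                                     refl (suc d) (q ^ ∣ Γ ∣) (q ^ ∣ Δ ∣) (Nclash ^ k) ⟩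
        suc d * (q ^ ∣ Γ ∣ * q ^ ∣ Δ ∣) * Nclash ^ k         ≤⟨ tail-domination {c = cΓ∪Δ} {Q = q ^ ∣ Γ ∪ Δ ∣} Nclash≤ enough ⟩
        q ^ ∣ Γ ∪ Δ ∣ * (Nclash + cΓ∪Δ) ^ k                 ≡⟨ cong (λ N → q ^ ∣ Γ ∪ Δ ∣ * N ^ k) (Ncompat≡Nclash+cΓ∪Δ small) ⟨
        main-term k                                         ∎

  ∣∪∣+∣∩∣ : ∀ {n} (Γ Δ : Subset n) → ∣ Γ ∪ Δ ∣ + ∣ Γ ∩ Δ ∣ ≡ ∣ Γ ∣ + ∣ Δ ∣
  ∣∪∣+∣∩∣ []          []          = refl
  ∣∪∣+∣∩∣ (true ∷ Γ)  (true ∷ Δ)  = cong suc (trans (ℕP.+-suc ∣ Γ ∪ Δ ∣ ∣ Γ ∩ Δ ∣)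
                                              (trans (cong suc (∣∪∣+∣∩∣ Γ Δ)) (sym (ℕP.+-suc ∣ Γ ∣ ∣ Δ ∣))))
  ∣∪∣+∣∩∣ (true ∷ Γ)  (false ∷ Δ) = cong suc (∣∪∣+∣∩∣ Γ Δ)
  ∣∪∣+∣∩∣ (false ∷ Γ) (true ∷ Δ)  = trans (cong suc (∣∪∣+∣∩∣ Γ Δ)) (sym (ℕP.+-suc ∣ Γ ∣ ∣ Δ ∣))
  ∣∪∣+∣∩∣ (false ∷ Γ) (false ∷ Δ) = ∣∪∣+∣∩∣ Γ Δ

  ∣∪∣-equal-sizes : ∀ {n t} (Γ Δ : Subset n) → ∣ Γ ∣ ≡ t → ∣ Δ ∣ ≡ t →
                    ∣ Γ ∪ Δ ∣ ≡ 2 * t ∸ ∣ Γ ∩ Δ ∣ × ∣ Γ ∪ Δ ∣ ≡ (t ∸ ∣ Γ ∩ Δ ∣) + t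
  ∣∪∣-equal-sizes {t = t} Γ Δ refl |Δ|≡t =
      trans ∣∪∣≡t+t∸r (cong (λ s → t + s ∸ ∣ Γ ∩ Δ ∣) (sym (ℕP.+-identityʳ t)))
    , trans ∣∪∣≡t+t∸r (ℕP.+-∸-comm t (∣p∩q∣≤∣p∣ Γ Δ))
    where
    ∣∪∣≡t+t∸r : ∣ Γ ∪ Δ ∣ ≡ t + t ∸ ∣ Γ ∩ Δ ∣
    ∣∪∣≡t+t∸r = begin
      ∣ Γ ∪ Δ ∣                            ≡⟨ ℕP.m+n∸n≡m ∣ Γ ∪ Δ ∣ ∣ Γ ∩ Δ ∣ ⟨
      ∣ Γ ∪ Δ ∣ + ∣ Γ ∩ Δ ∣ ∸ ∣ Γ ∩ Δ ∣      ≡⟨ cong (_∸ ∣ Γ ∩ Δ ∣) (trans (∣∪∣+∣∩∣ Γ Δ) (cong (t +_) |Δ|≡t)) ⟩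
      t + t ∸ ∣ Γ ∩ Δ ∣                    ∎
      where open ≡-Reasoning


module Rationals where

  open import Data.Nat as ℕ using (ℕ; zero; suc; _≤_; _^_; _∸_; NonZero)
  import Data.Nat.Properties as ℕP
  open import Data.Integer as ℤ using (+_)
  open import Data.Rational as ℚ using (ℚ; 0ℚ; 1ℚ; _+_; _*_; _-_; toℚᵘ)
  import Data.Rational.Properties as ℚP
  open import Data.Rational.Unnormalised as ℚᵘ using (mkℚᵘ; *≡*)
  import Data.Rational.Unnormalised.Properties as ℚᵘP
  open import Relation.Binary.PropositionalEquality
  import Data.Integer.Solver as ℤSolver
  module ℤS = ℤSolver.+-*-Solver
  import Data.Rational.Solver as ℚSolver
  module ℚS = ℚSolver.+-*-Solver
  open import Data.Product using (∃; _,_)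

  toℚᵘ-/ : ∀ a d → toℚᵘ (+ a ℚ./ suc d) ℚᵘ.≃ mkℚᵘ (+ a) d
  toℚᵘ-/ a d = ℚP.toℚᵘ-fromℚᵘ (mkℚᵘ (+ a) d)

  fromℕ-suc : ∀ a → fromℕ (suc a) ≡ 1ℚ + fromℕ a
  fromℕ-suc a = ℚP.toℚᵘ-injective (begin
    toℚᵘ (fromℕ (suc a))                   ≈⟨ toℚᵘ-/ (suc a) 0 ⟩
    mkℚᵘ (+ suc a) 0                       ≈⟨ *≡* (solve 1 (λ a → (con (+ 1) :+ a) :* con (+ 1) := (con (+ 1) :* con (+ 1) :+ a :* con (+ 1)) :* con (+ 1)) refl (+ a)) ⟩
    mkℚᵘ (+ 1) 0 ℚᵘ.+ mkℚᵘ (+ a) 0         ≈⟨ ℚᵘP.+-congʳ (mkℚᵘ (+ 1) 0) (toℚᵘ-/ a 0) ⟨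
    toℚᵘ 1ℚ ℚᵘ.+ toℚᵘ (fromℕ a)            ≈⟨ ℚP.toℚᵘ-homo-+ 1ℚ (fromℕ a) ⟨
    toℚᵘ (1ℚ + fromℕ a)                    ∎)
    where
    open ℚᵘP.≃-Reasoning
    open ℤS


  /-as-* : ∀ a m .{{_ : NonZero m}} → + a ℚ./ m ≡ fromℕ a * (+ 1 ℚ./ m)
  /-as-* a (suc m) = ℚP.toℚᵘ-injective (begin
    toℚᵘ (+ a ℚ./ suc m)                              ≈⟨ toℚᵘ-/ a m ⟩
    mkℚᵘ (+ a) m                                      ≈⟨ *≡* (solve 2 (λ a m → a :* (con (+ 1) :* (con (+ 1) :+ m)) := (a :* con (+ 1)) :* (con (+ 1) :+ m)) refl (+ a) (+ m)) ⟩
    mkℚᵘ (+ a) 0 ℚᵘ.* mkℚᵘ (+ 1) m                    ≈⟨ ℚᵘP.*-cong (toℚᵘ-/ a 0) (toℚᵘ-/ 1 m) ⟨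
    toℚᵘ (fromℕ a) ℚᵘ.* toℚᵘ (+ 1 ℚ./ suc m)          ≈⟨ ℚP.toℚᵘ-homo-* (fromℕ a) (+ 1 ℚ./ suc m) ⟨
    toℚᵘ (fromℕ a * (+ 1 ℚ./ suc m))                  ∎)
    where
    open ℚᵘP.≃-Reasoning
    open ℤS

  *-/-inverse : ∀ m .{{_ : NonZero m}} → fromℕ m * (+ 1 ℚ./ m) ≡ 1ℚ
  *-/-inverse (suc m) = ℚP.toℚᵘ-injective (begin
    toℚᵘ (fromℕ (suc m) * (+ 1 ℚ./ suc m))              ≈⟨ ℚP.toℚᵘ-homo-* (fromℕ (suc m)) (+ 1 ℚ./ suc m) ⟩
    toℚᵘ (fromℕ (suc m)) ℚᵘ.* toℚᵘ (+ 1 ℚ./ suc m)      ≈⟨ ℚᵘP.*-cong (toℚᵘ-/ (suc m) 0) (toℚᵘ-/ 1 m) ⟩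
    mkℚᵘ (+ suc m) 0 ℚᵘ.* mkℚᵘ (+ 1) m                  ≈⟨ *≡* (solve 1 (λ m → ((con (+ 1) :+ m) :* con (+ 1)) :* con (+ 1) := con (+ 1) :* (con (+ 1) :* (con (+ 1) :+ m))) refl (+ m)) ⟩
    toℚᵘ 1ℚ                                             ∎)
    where
    open ℚᵘP.≃-Reasoning
    open ℤS

  fromℕ-+ : ∀ a b → fromℕ (a ℕ.+ b) ≡ fromℕ a + fromℕ b
  fromℕ-+ zero    b = sym (ℚP.+-identityˡ (fromℕ b))
  fromℕ-+ (suc a) b = begin
    fromℕ (suc (a ℕ.+ b))        ≡⟨ fromℕ-suc (a ℕ.+ b) ⟩
    1ℚ + fromℕ (a ℕ.+ b)         ≡⟨ cong (λ x → 1ℚ + x) (fromℕ-+ a b) ⟩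
    1ℚ + (fromℕ a + fromℕ b)     ≡⟨ ℚP.+-assoc 1ℚ (fromℕ a) (fromℕ b) ⟨
    1ℚ + fromℕ a + fromℕ b       ≡⟨ cong (_+ fromℕ b) (fromℕ-suc a) ⟨
    fromℕ (suc a) + fromℕ b      ∎
    where open ≡-Reasoning

  fromℕ-* : ∀ a b → fromℕ (a ℕ.* b) ≡ fromℕ a * fromℕ b
  fromℕ-* zero    b = sym (ℚP.*-zeroˡ (fromℕ b))
  fromℕ-* (suc a) b = begin
    fromℕ (b ℕ.+ a ℕ.* b)           ≡⟨ fromℕ-+ b (a ℕ.* b) ⟩
    fromℕ b + fromℕ (a ℕ.* b)       ≡⟨ cong (λ x → fromℕ b + x) (fromℕ-* a b) ⟩
    fromℕ b + fromℕ a * fromℕ b     ≡⟨ cong (_+ fromℕ a * fromℕ b) (ℚP.*-identityˡ (fromℕ b)) ⟨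
    1ℚ * fromℕ b + fromℕ a * fromℕ b ≡⟨ ℚP.*-distribʳ-+ (fromℕ b) 1ℚ (fromℕ a) ⟨
    (1ℚ + fromℕ a) * fromℕ b        ≡⟨ cong (_* fromℕ b) (fromℕ-suc a) ⟨
    fromℕ (suc a) * fromℕ b         ∎
    where open ≡-Reasoning

  fromℕ-nonNeg : ∀ a → ℚ.NonNegative (fromℕ a)
  fromℕ-nonNeg a = ℚP.normalize-nonNeg a 1

  fromℕ-pos : ∀ a → ℚ.Positive (fromℕ (suc a))
  fromℕ-pos a = ℚP.normalize-pos (suc a) 1

  fromℕ-mono : ∀ {a b} → a ≤ b → fromℕ a ℚ.≤ fromℕ b
  fromℕ-mono {a} {b} a≤b = begin
    fromℕ a                    ≡⟨ ℚP.+-identityʳ (fromℕ a) ⟨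
    fromℕ a + 0ℚ               ≤⟨ ℚP.+-monoʳ-≤ (fromℕ a) (ℚP.nonNegative⁻¹ (fromℕ (b ℕ.∸ a)) {{fromℕ-nonNeg (b ℕ.∸ a)}}) ⟩
    fromℕ a + fromℕ (b ℕ.∸ a)  ≡⟨ fromℕ-+ a (b ℕ.∸ a) ⟨
    fromℕ (a ℕ.+ (b ℕ.∸ a))    ≡⟨ cong fromℕ (ℕP.m+[n∸m]≡n a≤b) ⟩
    fromℕ b                    ∎
    where open ℚP.≤-Reasoning

  archimedean : ∀ ε → 0ℚ ℚ.< ε → ∃ λ d → 1ℚ ℚ.≤ fromℕ (suc d) * ε
  archimedean ε@(ℚ.mkℚ ℤ.+[1+ p ] d _) _ = d , (begin
    1ℚ                                                ≤⟨ fromℕ-mono {1} {suc p} (ℕ.s≤s ℕ.z≤n) ⟩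
    fromℕ (suc p)                                     ≡⟨ ℚP.*-identityʳ (fromℕ (suc p)) ⟨
    fromℕ (suc p) * 1ℚ                                ≡⟨ cong (fromℕ (suc p) *_) (*-/-inverse (suc d)) ⟨
    fromℕ (suc p) * (fromℕ (suc d) * (+ 1 ℚ./ suc d)) ≡⟨ ℚS.solve 3 (λ a b c → a ℚS.:* (b ℚS.:* c) ℚS.:= b ℚS.:* (a ℚS.:* c)) refl (fromℕ (suc p)) (fromℕ (suc d)) (+ 1 ℚ./ suc d) ⟩
    fromℕ (suc d) * (fromℕ (suc p) * (+ 1 ℚ./ suc d)) ≡⟨ cong (fromℕ (suc d) *_) (/-as-* (suc p) (suc d)) ⟨
    fromℕ (suc d) * (+ suc p ℚ./ suc d)               ≡⟨ cong (fromℕ (suc d) *_) (ℚP.↥p/↧p≡p ε) ⟩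
    fromℕ (suc d) * ε                                 ∎)
    where open ℚP.≤-Reasoning
  archimedean (ℚ.mkℚ (+ 0) d _) 0<ε with () ← ℚ.positive 0<ε
  archimedean (ℚ.mkℚ ℤ.-[1+ p ] d _) 0<ε with () ← ℚ.positive 0<ε

  relative-error : ∀ d x y ε → suc d ℕ.* x ≤ suc d ℕ.* y ℕ.+ y → 1ℚ ℚ.≤ fromℕ (suc d) * ε →
                   fromℕ x ℚ.≤ fromℕ y * (1ℚ + ε)
  relative-error d x y ε x≤ 1≤ = ℚP.*-cancelˡ-≤-pos (fromℕ (suc d)) {{fromℕ-pos d}} (begin
    M * fromℕ x                  ≡⟨ fromℕ-* (suc d) x ⟨
    fromℕ (suc d ℕ.* x)          ≤⟨ fromℕ-mono x≤ ⟩
    fromℕ (suc d ℕ.* y ℕ.+ y)    ≡⟨ trans (fromℕ-+ (suc d ℕ.* y) y) (cong (_+ fromℕ y) (fromℕ-* (suc d) y)) ⟩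
    M * fromℕ y + fromℕ y        ≡⟨ cong (λ z → M * fromℕ y + z) (ℚP.*-identityˡ (fromℕ y)) ⟨
    M * fromℕ y + 1ℚ * fromℕ y   ≤⟨ ℚP.+-monoʳ-≤ (M * fromℕ y) (ℚP.*-monoʳ-≤-nonNeg (fromℕ y) {{fromℕ-nonNeg y}} 1≤) ⟩
    M * fromℕ y + M * ε * fromℕ y ≡⟨ ℚS.solve 3 (λ M y e → M ℚS.:* y ℚS.:+ M ℚS.:* e ℚS.:* y ℚS.:= M ℚS.:* (y ℚS.:* (ℚS.con 1ℚ ℚS.:+ e))) refl M (fromℕ y) ε ⟩
    M * (fromℕ y * (1ℚ + ε))     ∎)
    where
    open ℚP.≤-Reasoning
    M : ℚ
    M = fromℕ (suc d)

  powℚ-* : ∀ x y k → powℚ (x * y) k ≡ powℚ x k * powℚ y k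
  powℚ-* x y zero    = sym (ℚP.*-identityˡ 1ℚ)
  powℚ-* x y (suc k) = trans (cong (x * y *_) (powℚ-* x y k))
    (ℚS.solve 4 (λ x y a b → (x ℚS.:* y) ℚS.:* (a ℚS.:* b) ℚS.:= (x ℚS.:* a) ℚS.:* (y ℚS.:* b)) refl x y (powℚ x k) (powℚ y k))

  powℚ-fromℕ : ∀ a k → powℚ (fromℕ a) k ≡ fromℕ (a ^ k)
  powℚ-fromℕ a zero    = refl
  powℚ-fromℕ a (suc k) = trans (cong (fromℕ a *_) (powℚ-fromℕ a k)) (sym (fromℕ-* a (a ^ k)))

  module NegativePowers (q′ : ℕ) where

    q : ℕ
    q = suc q′

    q⁻ : ℕ → ℚ
    q⁻ e = divPow 1 q e

    divPow≡ : ∀ a e → divPow a q e ≡ fromℕ a * q⁻ e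
    divPow≡ a e = /-as-* a (q ^ e) {{ℕP.m^n≢0 q e}}

    q^*q⁻ : ∀ e → fromℕ (q ^ e) * q⁻ e ≡ 1ℚ
    q^*q⁻ e = *-/-inverse (q ^ e) {{ℕP.m^n≢0 q e}}

    q⁻-unique : ∀ e z → fromℕ (q ^ e) * z ≡ 1ℚ → z ≡ q⁻ e
    q⁻-unique e z inverse = begin
      z                          ≡⟨ ℚP.*-identityˡ z ⟨
      1ℚ * z                     ≡⟨ cong (_* z) (q^*q⁻ e) ⟨
      fromℕ (q ^ e) * q⁻ e * z   ≡⟨ ℚS.solve 3 (λ a b c → (a ℚS.:* b) ℚS.:* c ℚS.:= b ℚS.:* (a ℚS.:* c)) refl (fromℕ (q ^ e)) (q⁻ e) z ⟩
      q⁻ e * (fromℕ (q ^ e) * z) ≡⟨ cong (q⁻ e *_) inverse ⟩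
      q⁻ e * 1ℚ                  ≡⟨ ℚP.*-identityʳ (q⁻ e) ⟩
      q⁻ e                       ∎
      where open ≡-Reasoning

    q⁻-+ : ∀ a b → q⁻ (a ℕ.+ b) ≡ q⁻ a * q⁻ b
    q⁻-+ a b = sym (q⁻-unique (a ℕ.+ b) (q⁻ a * q⁻ b) (begin
      fromℕ (q ^ (a ℕ.+ b)) * (q⁻ a * q⁻ b)              ≡⟨ cong (λ x → fromℕ x * (q⁻ a * q⁻ b)) (ℕP.^-distribˡ-+-* q a b) ⟩
      fromℕ (q ^ a ℕ.* q ^ b) * (q⁻ a * q⁻ b)            ≡⟨ cong (_* (q⁻ a * q⁻ b)) (fromℕ-* (q ^ a) (q ^ b)) ⟩
      fromℕ (q ^ a) * fromℕ (q ^ b) * (q⁻ a * q⁻ b)      ≡⟨ ℚS.solve 4 (λ a b c d → (a ℚS.:* b) ℚS.:* (c ℚS.:* d) ℚS.:= (a ℚS.:* c) ℚS.:* (b ℚS.:* d)) refl (fromℕ (q ^ a)) (fromℕ (q ^ b)) (q⁻ a) (q⁻ b) ⟩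
      fromℕ (q ^ a) * q⁻ a * (fromℕ (q ^ b) * q⁻ b)      ≡⟨ cong₂ _*_ (q^*q⁻ a) (q^*q⁻ b) ⟩
      1ℚ * 1ℚ                                            ≡⟨ ℚP.*-identityˡ 1ℚ ⟩
      1ℚ                                                 ∎))
      where open ≡-Reasoning

    q⁻-scale : ∀ c e e′ → c ℕ.* q ^ e ≡ q ^ e′ → fromℕ c * q⁻ e′ ≡ q⁻ e
    q⁻-scale c e e′ eq = q⁻-unique e (fromℕ c * q⁻ e′) (begin
      fromℕ (q ^ e) * (fromℕ c * q⁻ e′)  ≡⟨ ℚS.solve 3 (λ a b c → a ℚS.:* (b ℚS.:* c) ℚS.:= (b ℚS.:* a) ℚS.:* c) refl (fromℕ (q ^ e)) (fromℕ c) (q⁻ e′) ⟩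
      fromℕ c * fromℕ (q ^ e) * q⁻ e′    ≡⟨ cong (_* q⁻ e′) (fromℕ-* c (q ^ e)) ⟨
      fromℕ (c ℕ.* q ^ e) * q⁻ e′        ≡⟨ cong (λ x → fromℕ x * q⁻ e′) eq ⟩
      fromℕ (q ^ e′) * q⁻ e′             ≡⟨ q^*q⁻ e′ ⟩
      1ℚ                                 ∎)
      where open ≡-Reasoning

    powℚ-q⁻ : ∀ e k → powℚ (q⁻ e) k ≡ q⁻ (k ℕ.* e)
    powℚ-q⁻ e zero    = refl
    powℚ-q⁻ e (suc k) = trans (cong (q⁻ e *_) (powℚ-q⁻ e k)) (sym (q⁻-+ e (k ℕ.* e)))

    -- The base of the power in boundMain is N/q^n, where N = q^n - 2c + C is the
    -- number of rows missing a compatible pair (c = q^(n-t), C = q^(n-m)):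
    --   (q^t + q^(r-t) - 2) / q^t  =  1 + q^(-m) - 2 q^(-t)  =  N / q^n.
    base≡ : ∀ n t r m N c C → N ℕ.+ (c ℕ.+ c) ≡ q ^ n ℕ.+ C → c ℕ.* q ^ t ≡ q ^ n →
            C ℕ.* q ^ m ≡ q ^ n → m ≡ (t ∸ r) ℕ.+ t →
            (fromℕ (q ^ t) + q⁻ (t ∸ r) - fromℕ 2) * q⁻ t ≡ fromℕ N * q⁻ n
    base≡ n t r m N c C balance c-exact C-exact m≡ = trans lhs (sym rhs)
      where
      open ≡-Reasoning
      open ℚS
      one+q⁻m-2q⁻t : ℚ
      one+q⁻m-2q⁻t = 1ℚ + q⁻ (t ∸ r) * q⁻ t - q⁻ t - q⁻ t
      lhs : (fromℕ (q ^ t) + q⁻ (t ∸ r) - fromℕ 2) * q⁻ t ≡ one+q⁻m-2q⁻t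
      lhs = begin
        (fromℕ (q ^ t) + q⁻ (t ∸ r) - fromℕ 2) * q⁻ t
          ≡⟨ cong (λ x → (fromℕ (q ^ t) + q⁻ (t ∸ r) - x) * q⁻ t) (fromℕ-+ 1 1) ⟩
        (fromℕ (q ^ t) + q⁻ (t ∸ r) - (1ℚ + 1ℚ)) * q⁻ t
          ≡⟨ ℚS.solve 3 (λ Q a b → (Q :+ a :- (con 1ℚ :+ con 1ℚ)) :* b := Q :* b :+ a :* b :- b :- b) refl (fromℕ (q ^ t)) (q⁻ (t ∸ r)) (q⁻ t) ⟩
        fromℕ (q ^ t) * q⁻ t + q⁻ (t ∸ r) * q⁻ t - q⁻ t - q⁻ t
          ≡⟨ cong (λ x → x + q⁻ (t ∸ r) * q⁻ t - q⁻ t - q⁻ t) (q^*q⁻ t) ⟩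
        one+q⁻m-2q⁻t ∎
      rhs : fromℕ N * q⁻ n ≡ one+q⁻m-2q⁻t
      rhs = begin
        fromℕ N * q⁻ n
          ≡⟨ ℚS.solve 3 (λ N c x → N :* x := (N :+ (c :+ c)) :* x :- c :* x :- c :* x) refl (fromℕ N) (fromℕ c) (q⁻ n) ⟩
        (fromℕ N + (fromℕ c + fromℕ c)) * q⁻ n - fromℕ c * q⁻ n - fromℕ c * q⁻ n
          ≡⟨ cong₂ (λ x y → x * q⁻ n - y - y) balanceℚ (q⁻-scale c t n c-exact) ⟩
        (fromℕ (q ^ n) + fromℕ C) * q⁻ n - q⁻ t - q⁻ t
          ≡⟨ cong (λ x → x - q⁻ t - q⁻ t) (ℚP.*-distribʳ-+ (q⁻ n) (fromℕ (q ^ n)) (fromℕ C)) ⟩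
        fromℕ (q ^ n) * q⁻ n + fromℕ C * q⁻ n - q⁻ t - q⁻ t
          ≡⟨ cong₂ (λ x y → x + y - q⁻ t - q⁻ t) (q^*q⁻ n) (trans (q⁻-scale C m n C-exact) (trans (cong q⁻ m≡) (q⁻-+ (t ∸ r) t))) ⟩
        one+q⁻m-2q⁻t ∎
        where
        balanceℚ : fromℕ N + (fromℕ c + fromℕ c) ≡ fromℕ (q ^ n) + fromℕ C
        balanceℚ = begin
          fromℕ N + (fromℕ c + fromℕ c)  ≡⟨ cong (λ x → fromℕ N + x) (fromℕ-+ c c) ⟨
          fromℕ N + fromℕ (c ℕ.+ c)      ≡⟨ fromℕ-+ N (c ℕ.+ c) ⟨
          fromℕ (N ℕ.+ (c ℕ.+ c))        ≡⟨ cong fromℕ balance ⟩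
          fromℕ (q ^ n ℕ.+ C)            ≡⟨ fromℕ-+ (q ^ n) C ⟩
          fromℕ (q ^ n) + fromℕ C        ∎

    boundMain≡ : ∀ n t r m N c C k → N ℕ.+ (c ℕ.+ c) ≡ q ^ n ℕ.+ C → c ℕ.* q ^ t ≡ q ^ n →
                 C ℕ.* q ^ m ≡ q ^ n → m ≡ (t ∸ r) ℕ.+ t → m ≡ 2 ℕ.* t ∸ r →
                 boundMain q t r k ≡ fromℕ (q ^ m ℕ.* N ^ k) * q⁻ (k ℕ.* n)
    boundMain≡ n t r m N c C k balance c-exact C-exact m≡ m≡′ = begin
      fromℕ (q ^ (2 ℕ.* t ∸ r)) * powℚ ((fromℕ (q ^ t) + q⁻ (t ∸ r) - fromℕ 2) * q⁻ t) k
        ≡⟨ cong₂ (λ e x → fromℕ (q ^ e) * powℚ x k) (sym m≡′) (base≡ n t r m N c C balance c-exact C-exact m≡) ⟩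
      fromℕ (q ^ m) * powℚ (fromℕ N * q⁻ n) k
        ≡⟨ cong (fromℕ (q ^ m) *_) (trans (powℚ-* (fromℕ N) (q⁻ n) k) (cong₂ _*_ (powℚ-fromℕ N k) (powℚ-q⁻ n k))) ⟩
      fromℕ (q ^ m) * (fromℕ (N ^ k) * q⁻ (k ℕ.* n))
        ≡⟨ ℚP.*-assoc (fromℕ (q ^ m)) _ _ ⟨
      fromℕ (q ^ m) * fromℕ (N ^ k) * q⁻ (k ℕ.* n)
        ≡⟨ cong (_* q⁻ (k ℕ.* n)) (fromℕ-* (q ^ m) (N ^ k)) ⟨
      fromℕ (q ^ m ℕ.* N ^ k) * q⁻ (k ℕ.* n) ∎
      where open ≡-Reasoning

    q⁻-nonNeg : ∀ e → ℚ.NonNegative (q⁻ e)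
    q⁻-nonNeg e = ℚP.normalize-nonNeg 1 (q ^ e) {{ℕP.m^n≢0 q e}}

    probability-bound : ∀ c M e ε → fromℕ c ℚ.≤ fromℕ M * (1ℚ + ε) → divPow c q e ℚ.≤ fromℕ M * q⁻ e * (1ℚ + ε)
    probability-bound c M e ε c≤ = begin
      divPow c q e                 ≡⟨ divPow≡ c e ⟩
      fromℕ c * q⁻ e               ≤⟨ ℚP.*-monoʳ-≤-nonNeg (q⁻ e) {{q⁻-nonNeg e}} c≤ ⟩
      fromℕ M * (1ℚ + ε) * q⁻ e    ≡⟨ ℚS.solve 3 (λ M x y → M ℚS.:* x ℚS.:* y ℚS.:= M ℚS.:* y ℚS.:* x) refl (fromℕ M) (1ℚ + ε) (q⁻ e) ⟩
      fromℕ M * q⁻ e * (1ℚ + ε)    ∎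
      where open ℚP.≤-Reasoning


open Combinatorics using (module ColumnPair; ∣∪∣-equal-sizes; ^-∸-split; double-≤)
open Rationals using (archimedean; relative-error; module NegativePowers)

open import Data.Nat using (ℕ; _≤_; _^_; suc; z≤n; s≤s)
import Data.Nat as ℕ
import Data.Nat.Properties as ℕP
open import Data.Rational using (ℚ; 0ℚ; 1ℚ; _<_; _+_; _*_) renaming (_≤_ to _≤ℚ_)
import Data.Rational.Properties as ℚP
open import Data.Fin.Subset using (Subset; _∩_; _∪_; ∣_∣; Nonempty)
open import Data.Fin.Subset.Properties using (∣p∣≤n)
open import Data.Product using (∃-syntax; _,_; proj₁; proj₂)
open import Relation.Binary.PropositionalEquality using (_≡_; _≢_; refl; sym; trans; cong; subst)

estimate : ∀ q″ t d j ε n (Γ Δ : Subset n) → 1 ≤ t → ∣ Γ ∣ ≡ t → ∣ Δ ∣ ≡ t →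
           suc d ℕ.* (suc (suc q″) ^ t ℕ.* suc (suc q″) ^ t) ≤ j → 1ℚ ≤ℚ fromℕ (suc d) * ε →
           probBoth (suc (suc q″)) (suc j) n Γ Δ ≤ℚ boundMain (suc (suc q″)) t ∣ Γ ∩ Δ ∣ (suc j) * (1ℚ + ε)
estimate q″ .(∣ Γ ∣) d j ε n Γ Δ 1≤t refl |Δ|≡t enough 1≤dε = begin
  probBoth q k n Γ Δ                              ≤⟨ probability-bound (countBoth q k n Γ Δ) (main-term k) (k ℕ.* n) ε rational-estimate ⟩
  fromℕ (main-term k) * q⁻ (k ℕ.* n) * (1ℚ + ε)    ≡⟨ cong (_* (1ℚ + ε)) bound≡ ⟨
  boundMain q t r k * (1ℚ + ε)                    ∎
  where
  open ColumnPair (suc q″) n Γ Δ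
  open NegativePowers (suc q″) using (q⁻; boundMain≡; probability-bound)
  open ℚP.≤-Reasoning
  t r m k : ℕ
  t = ∣ Γ ∣
  r = ∣ Γ ∩ Δ ∣
  m = ∣ Γ ∪ Δ ∣
  k = suc j

  cΔ≡cΓ : cΔ ≡ cΓ
  cΔ≡cΓ = cong (λ s → q ^ (n ℕ.∸ s)) |Δ|≡t

  -- q^t ≥ 2, so the rows carrying a fixed word on Γ or on Δ are not all rows.
  small : cΓ ℕ.+ cΔ ≤ q ^ n
  small = subst (λ c → cΓ ℕ.+ c ≤ q ^ n) (sym cΔ≡cΓ)
    (double-≤ q (ℕP.≤-trans (s≤s (s≤s z≤n)) (ℕP.^-monoʳ-≤ q 1≤t)) (∣p∣≤n Γ))

  integer-estimate : suc d ℕ.* countBoth q k n Γ Δ ≤ suc d ℕ.* main-term k ℕ.+ main-term k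
  integer-estimate = count-both-relative d j small (subst (λ s → suc d ℕ.* (q ^ t ℕ.* q ^ s) ≤ j) (sym |Δ|≡t) enough)

  rational-estimate : fromℕ (countBoth q k n Γ Δ) ≤ℚ fromℕ (main-term k) * (1ℚ + ε)
  rational-estimate = relative-error d (countBoth q k n Γ Δ) (main-term k) ε integer-estimate 1≤dε

  bound≡ : boundMain q t r k ≡ fromℕ (main-term k) * q⁻ (k ℕ.* n)
  bound≡ = boundMain≡ n t r m Ncompat cΓ cΓ∪Δ k
    (subst (λ c → Ncompat ℕ.+ (cΓ ℕ.+ c) ≡ q ^ n ℕ.+ cΓ∪Δ) cΔ≡cΓ (Ncompat-balance small))
    (^-∸-split q (∣p∣≤n Γ)) (^-∸-split q (∣p∣≤n (Γ ∪ Δ)))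
    (proj₂ (∣∪∣-equal-sizes Γ Δ refl |Δ|≡t)) (proj₁ (∣∪∣-equal-sizes Γ Δ refl |Δ|≡t))

lemma2p5 : (q t : ℕ) → 2 ≤ q → 2 ≤ t →
    ∀ (ε : ℚ) → 0ℚ < ε →
    ∃[ K ] (∀ (k : ℕ) → K ≤ k →
    ∀ (n : ℕ) (Γ Δ : Subset n) →
    ∣ Γ ∣ ≡ t → ∣ Δ ∣ ≡ t → Γ ≢ Δ → Nonempty (Γ ∩ Δ) →
    probBoth q k n Γ Δ ≤ℚ boundMain q t ∣ Γ ∩ Δ ∣ k * (1ℚ + ε))
lemma2p5 (suc (suc q″)) t (s≤s (s≤s z≤n)) 2≤t ε ε>0 = K , eventually
  where
  q : ℕ
  q = suc (suc q″)
  d : ℕ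
  d = proj₁ (archimedean ε ε>0)
  K : ℕ
  K = suc (suc d ℕ.* (q ^ t ℕ.* q ^ t))
  eventually : ∀ k → K ≤ k → ∀ n (Γ Δ : Subset n) → ∣ Γ ∣ ≡ t → ∣ Δ ∣ ≡ t → Γ ≢ Δ → Nonempty (Γ ∩ Δ) →
               probBoth q k n Γ Δ ≤ℚ boundMain q t ∣ Γ ∩ Δ ∣ k * (1ℚ + ε)
  eventually (suc j) (s≤s enough) n Γ Δ |Γ|≡t |Δ|≡t _ _ =
    estimate q″ t d j ε n Γ Δ (ℕP.≤-trans (s≤s z≤n) 2≤t) |Γ|≡t |Δ|≡t enough (proj₂ (archimedean ε ε>0))
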